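{- Let $k$ be a positive integer, let $X$ be a non-empty subset of $\{0,1\}^k$, and let $r$ be a power of $2$. Then there exists an integer $n \ge k$ such that the family of all isometric copies of $X$ in $\{0,1\}^n$ contains an $r$-fold partition modulo $r$ of $\{0,1\}^n$; that is, there is an assignment of non-negative integer weights to the isometric copies of $X$ in $\{0,1\}^n$ such that, for every $p \in \{0,1\}^n$, the sum of the weights of the copies containing $p$ is congruent to $1 \pmod r$.
   Context: $\{0,1\}^n$ carries the Hamming distance ($d(x,y)$ = number of coordinates where $x,y$ differ). For $n \ge k$, $Y \subset \{0,1\}^n$ is an isometric copy of $X \subset \{0,1\}^k$ if $Y = \phi(X)$ for some distance-preserving map $\phi:\{0,1\}^k \to \{0,1\}^n$. The multiplicities of different points need not be equal, only congruent to $1$ modulo $r$. -}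

module Defs where

open import Data.Nat using (ℕ; zero; suc; _+_; _≥_; _^_)
open import Data.Bool using (Bool; true; false; _≟_)
open import Data.Vec using (Vec; []; _∷_)
open import Data.List using (List; []; _∷_)
open import Data.Product using (Σ; ∃; _×_; _,_)
open import Relation.Binary.PropositionalEquality using (_≡_)
open import Relation.Nullary using (yes; no)
open import Function.Bundles using (_⇔_)
open import Data.Integer using (ℤ; +_; _-_)
open import Data.Integer.Divisibility using (_∣_)

Point : ℕ → Set
Point n = Vec Bool n

hamming : ∀ {n} → Point n → Point n → ℕ
hamming []       []       = 0
hamming (a ∷ x) (b ∷ y) with a ≟ b
... | yes _ = hamming x y
... | no  _ = suc (hamming x y)

Subcube : ℕ → Set
Subcube n = Point n → Bool

_∈ₛ_ : ∀ {n} → Point n → Subcube n → Set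
p ∈ₛ Y = Y p ≡ true

NonEmpty : ∀ {n} → Subcube n → Set
NonEmpty {n} X = Σ (Point n) λ x → x ∈ₛ X

IsIsometry : ∀ {k n} → (Point k → Point n) → Set
IsIsometry {k} φ = ∀ (x y : Point k) → hamming (φ x) (φ y) ≡ hamming x y

IsIsometricCopy : ∀ {k n} → Subcube k → Subcube n → Set
IsIsometricCopy {k} {n} X Y =
  Σ (Point k → Point n) λ φ → IsIsometry φ ×
    (∀ (p : Point n) → (p ∈ₛ Y) ⇔ (Σ (Point k) λ x → (x ∈ₛ X) × (φ x ≡ p)))

record WeightedCopy {k : ℕ} (n : ℕ) (X : Subcube k) : Set where
  field
    copy   : Subcube n
    isCopy : IsIsometricCopy X copy
    weight : ℕ
open WeightedCopy public

weightAt : ∀ {k n} {X : Subcube k} → List (WeightedCopy n X) → Point n → ℕ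
weightAt []       p = 0
weightAt (c ∷ cs) p with copy c p
... | true  = weight c + weightAt cs p
... | false = weightAt cs p

_≡_[mod_] : ℕ → ℕ → ℕ → Set
a ≡ b [mod r ] = (+ r) ∣ ((+ a) - (+ b))

IsPowerOf2 : ℕ → Set
IsPowerOf2 r = ∃ λ m → r ≡ 2 ^ m

-- Translates of X already give an odd cover: splitting off one coordinate, either the two
-- slices of X are equal (and X is a cylinder over a slice), or their symmetric difference D
-- is non-empty, and an odd cover by translates of D doubles to one of X, because
-- |F| + |G| ≡ |F xor G| mod 2. Covers are then lifted from modulus 2 to 2^m by a product
-- construction: if x ≡ 1 mod r and y ≡ 1 mod r', then x + y + (r r' − 1) x y ≡ 1 − (1 − x)(1 − y)
-- ≡ 1 mod r r', and on {0,1}^a × {0,1}^b this weight is realised by placing copies of X in the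
-- fibres of the two projections.
module Submission where

open import Defs
open import Data.Nat using (ℕ; zero; suc; _+_; _*_; _^_; _≥_; pred)
open import Data.Nat.Properties using (+-comm; +-assoc; +-identityʳ; *-zeroʳ; *-identityˡ;
  *-distribˡ-+; ≤-refl; m≤m+n; suc-pred; m^n≢0)
open import Data.Nat.Divisibility using (n∣m*n*o)
open import Data.Nat.Tactic.RingSolver using (solve-∀)
open import Data.Bool using (Bool; true; false; _∧_; _xor_; _≟_)
open import Data.Bool.Properties using (∧-identityʳ; ∧-zeroʳ)
open import Data.Vec using ([]; _∷_; _++_; zipWith; take; drop)
open import Data.Vec.Properties using (take++drop≡id; ++-injectiveˡ; ++-injectiveʳ; ∷-injectiveʳ; ≡-dec)
open import Data.List using (List; []; _∷_; map) renaming (_++_ to _++ₗ_)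
open import Data.Product using (Σ; _×_; _,_; proj₁; proj₂)
open import Data.Sum using (_⊎_; inj₁; inj₂)
open import Function using (const; _∘_; case_of_)
open import Function.Bundles using (_⇔_; mk⇔; Equivalence)
open import Relation.Nullary using (does; yes; no; contradiction)
open import Relation.Nullary.Decidable using (dec-true; dec-false)
open import Relation.Binary.Definitions using (DecidableEquality)
open import Relation.Binary.PropositionalEquality

_≟ₚ_ : ∀ {n} → DecidableEquality (Point n)
_≟ₚ_ = ≡-dec _≟_

hamming-refl : ∀ {n} (x : Point n) → hamming x x ≡ 0
hamming-refl [] = refl
hamming-refl (a ∷ x) with a ≟ a
... | yes _ = hamming-refl x
... | no a≢a = contradiction refl a≢a

hamming-++ : ∀ {a b} (x y : Point a) (u v : Point b) →
  hamming (x ++ u) (y ++ v) ≡ hamming x y + hamming u v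
hamming-++ [] [] u v = refl
hamming-++ (a ∷ x) (b ∷ y) u v with a ≟ b
... | yes _ = hamming-++ x y u v
... | no _ = cong suc (hamming-++ x y u v)

_⊕_ : ∀ {n} → Point n → Point n → Point n
_⊕_ = zipWith _xor_

⊕-cancelʳ : ∀ {n} (x a : Point n) → (x ⊕ a) ⊕ a ≡ x
⊕-cancelʳ [] [] = refl
⊕-cancelʳ (true ∷ xs) (true ∷ as) = cong (true ∷_) (⊕-cancelʳ xs as)
⊕-cancelʳ (true ∷ xs) (false ∷ as) = cong (true ∷_) (⊕-cancelʳ xs as)
⊕-cancelʳ (false ∷ xs) (true ∷ as) = cong (false ∷_) (⊕-cancelʳ xs as)
⊕-cancelʳ (false ∷ xs) (false ∷ as) = cong (false ∷_) (⊕-cancelʳ xs as)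

hamming-⊕ : ∀ {n} (x y c : Point n) → hamming (x ⊕ c) (y ⊕ c) ≡ hamming x y
hamming-⊕ [] [] [] = refl
hamming-⊕ (true ∷ x) (true ∷ y) (true ∷ c) = hamming-⊕ x y c
hamming-⊕ (true ∷ x) (true ∷ y) (false ∷ c) = hamming-⊕ x y c
hamming-⊕ (false ∷ x) (false ∷ y) (true ∷ c) = hamming-⊕ x y c
hamming-⊕ (false ∷ x) (false ∷ y) (false ∷ c) = hamming-⊕ x y c
hamming-⊕ (true ∷ x) (false ∷ y) (true ∷ c) = cong suc (hamming-⊕ x y c)
hamming-⊕ (true ∷ x) (false ∷ y) (false ∷ c) = cong suc (hamming-⊕ x y c)
hamming-⊕ (false ∷ x) (true ∷ y) (true ∷ c) = cong suc (hamming-⊕ x y c)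
hamming-⊕ (false ∷ x) (true ∷ y) (false ∷ c) = cong suc (hamming-⊕ x y c)

-- Odd covers by translates

translate : ∀ {n} (X : Subcube n) → Point n → WeightedCopy n X
translate {n} X a = record
  { copy = λ p → X (p ⊕ a)
  ; isCopy = (_⊕ a) , (λ x y → hamming-⊕ x y a) , λ p → mk⇔ (to p) (from p)
  ; weight = 1 }
  where
  to : ∀ p → X (p ⊕ a) ≡ true → Σ (Point n) λ x → (x ∈ₛ X) × (x ⊕ a ≡ p)
  to p p⊕a∈X = p ⊕ a , p⊕a∈X , ⊕-cancelʳ p a
  from : ∀ p → (Σ (Point n) λ x → (x ∈ₛ X) × (x ⊕ a ≡ p)) → X (p ⊕ a) ≡ true
  from .(x ⊕ a) (x , x∈X , refl) = trans (cong X (⊕-cancelʳ x a)) x∈X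

bit : Bool → ℕ
bit true = 1
bit false = 0

hits : ∀ {n} → Subcube n → List (Point n) → Point n → ℕ
hits X [] p = 0
hits X (a ∷ A) p = bit (X (p ⊕ a)) + hits X A p

weightAt-translates : ∀ {n} (X : Subcube n) A p → weightAt (map (translate X) A) p ≡ hits X A p
weightAt-translates X [] p = refl
weightAt-translates X (a ∷ A) p with X (p ⊕ a)
... | true = cong suc (weightAt-translates X A p)
... | false = weightAt-translates X A p

hits-++ : ∀ {n} (X : Subcube n) A B p → hits X (A ++ₗ B) p ≡ hits X A p + hits X B p
hits-++ X [] B p = refl
hits-++ X (a ∷ A) B p =
  trans (cong (bit (X (p ⊕ a)) +_) (hits-++ X A B p)) (sym (+-assoc (bit (X (p ⊕ a))) _ _))

hits-cong : ∀ {n} {F G : Subcube n} → (∀ y → F y ≡ G y) → ∀ A p → hits F A p ≡ hits G A p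
hits-cong F≗G [] p = refl
hits-cong F≗G (a ∷ A) p = cong₂ _+_ (cong bit (F≗G (p ⊕ a))) (hits-cong F≗G A p)

slice : ∀ {n} → Subcube (suc n) → Bool → Subcube n
slice X b y = X (b ∷ y)

sliceDifference : ∀ {n} → Subcube (suc n) → Subcube n
sliceDifference X y = slice X false y xor slice X true y

hits-∷ : ∀ {n} (X : Subcube (suc n)) c b A p →
  hits X (map (c ∷_) A) (b ∷ p) ≡ hits (slice X (b xor c)) A p
hits-∷ X c b [] p = refl
hits-∷ X c b (a ∷ A) p = cong (bit (X ((b xor c) ∷ (p ⊕ a))) +_) (hits-∷ X c b A p)

bit-+ : ∀ f g → bit f + bit g ≡ bit (f xor g) + 2 * bit (f ∧ g)
bit-+ true true = refl
bit-+ true false = refl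
bit-+ false true = refl
bit-+ false false = refl

hits-+ : ∀ {n} (F G : Subcube n) A p →
  hits F A p + hits G A p ≡ hits (λ y → F y xor G y) A p + 2 * hits (λ y → F y ∧ G y) A p
hits-+ F G [] p = refl
hits-+ F G (a ∷ A) p = begin
  (bit f + hits F A p) + (bit g + hits G A p)   ≡⟨ regroup (bit f) (hits F A p) (bit g) (hits G A p) ⟩
  (bit f + bit g) + (hits F A p + hits G A p)   ≡⟨ cong₂ _+_ (bit-+ f g) (hits-+ F G A p) ⟩
  (bit (f xor g) + 2 * bit (f ∧ g)) + (hits (λ y → F y xor G y) A p + 2 * hits (λ y → F y ∧ G y) A p)
    ≡⟨ regroup₂ (bit (f xor g)) (bit (f ∧ g)) _ _ ⟩
  (bit (f xor g) + hits (λ y → F y xor G y) A p) + 2 * (bit (f ∧ g) + hits (λ y → F y ∧ G y) A p) ∎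
  where
  open ≡-Reasoning
  f = F (p ⊕ a)
  g = G (p ⊕ a)
  regroup : ∀ x y z w → (x + y) + (z + w) ≡ (x + z) + (y + w)
  regroup = solve-∀
  regroup₂ : ∀ x y z w → (x + 2 * y) + (z + 2 * w) ≡ (x + z) + 2 * (y + w)
  regroup₂ = solve-∀

OneMod : ℕ → ℕ → Set
OneMod r u = Σ ℕ λ s → u ≡ 1 + r * s

oneMod-+-multiple : ∀ {r u} v → OneMod r u → OneMod r (u + r * v)
oneMod-+-multiple {r} v (s , refl) = s + v , cong suc (sym (*-distribˡ-+ r s v))

findTrue : ∀ n (P : Point n → Bool) → (Σ (Point n) λ y → P y ≡ true) ⊎ (∀ y → P y ≡ false)
findTrue zero P with P [] in P[]
... | true = inj₁ ([] , P[])
... | false = inj₂ λ { [] → P[] }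
findTrue (suc n) P with findTrue n (P ∘ (false ∷_)) | findTrue n (P ∘ (true ∷_))
... | inj₁ (y , Py) | _ = inj₁ (false ∷ y , Py)
... | inj₂ _ | inj₁ (y , Py) = inj₁ (true ∷ y , Py)
... | inj₂ none₀ | inj₂ none₁ = inj₂ λ { (false ∷ y) → none₀ y ; (true ∷ y) → none₁ y }

OddCover : ∀ {n} → Subcube n → List (Point n) → Set
OddCover {n} X A = ∀ (p : Point n) → OneMod 2 (hits X A p)

oddCover-both : ∀ {n} (X : Subcube (suc n)) A →
  OddCover (sliceDifference X) A →
  OddCover X (map (false ∷_) A ++ₗ map (true ∷_) A)
oddCover-both X A odd (b ∷ p) =
  subst (OneMod 2) (sym (hits-++ X (map (false ∷_) A) (map (true ∷_) A) (b ∷ p))) (slices b)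
  where
  sum-odd : ∀ (F G : Subcube _) → OddCover (λ y → F y xor G y) A → OneMod 2 (hits F A p + hits G A p)
  sum-odd F G oddFG =
    subst (OneMod 2) (sym (hits-+ F G A p)) (oneMod-+-multiple {2} (hits (λ y → F y ∧ G y) A p) (oddFG p))
  slices : ∀ b → OneMod 2 (hits X (map (false ∷_) A) (b ∷ p) + hits X (map (true ∷_) A) (b ∷ p))
  slices b rewrite hits-∷ X false b A p | hits-∷ X true b A p with b
  ... | false = sum-odd (slice X false) (slice X true) odd
  ... | true = subst (OneMod 2) (+-comm (hits (slice X false) A p) _)
                 (sum-odd (slice X false) (slice X true) odd)

oddCover-cylinder : ∀ {n} (X : Subcube (suc n)) A → (∀ y → slice X false y ≡ slice X true y) →
  OddCover (slice X false) A → OddCover X (map (false ∷_) A)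
oddCover-cylinder X A X₀≗X₁ odd (false ∷ p) = subst (OneMod 2) (sym (hits-∷ X false false A p)) (odd p)
oddCover-cylinder X A X₀≗X₁ odd (true ∷ p) =
  subst (OneMod 2) (sym (trans (hits-∷ X false true A p) (hits-cong (sym ∘ X₀≗X₁) A p))) (odd p)

xor≡false⇒≡ : ∀ a b → a xor b ≡ false → a ≡ b
xor≡false⇒≡ true true _ = refl
xor≡false⇒≡ false false _ = refl

oddCover : ∀ n (X : Subcube n) → NonEmpty X → Σ (List (Point n)) (OddCover X)
oddCover zero X ([] , x∈X) = [] ∷ [] , λ { [] → 0 , cong (λ b → bit b + 0) x∈X }
oddCover (suc n) X ne with findTrue n (sliceDifference X)
... | inj₁ D≢∅ = let A , odd = oddCover n (sliceDifference X) D≢∅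
                 in map (false ∷_) A ++ₗ map (true ∷_) A , oddCover-both X A odd
... | inj₂ D≡∅ = let A , odd = oddCover n (slice X false) ne₀
                 in map (false ∷_) A , oddCover-cylinder X A X₀≗X₁ odd
  where
  X₀≗X₁ : ∀ y → slice X false y ≡ slice X true y
  X₀≗X₁ y = xor≡false⇒≡ _ _ (D≡∅ y)
  ne₀ : NonEmpty (slice X false)
  ne₀ = case ne of λ where
    (false ∷ y , x∈X) → y , x∈X
    (true ∷ y , x∈X) → y , trans (X₀≗X₁ y) x∈X

oddTranslates : ∀ {n} (X : Subcube n) → NonEmpty X →
  Σ (List (WeightedCopy n X)) λ ws → ∀ p → OneMod 2 (weightAt ws p)
oddTranslates {n} X ne =
  let A , odd = oddCover n X ne
  in map (translate X) A , λ p → subst (OneMod 2) (sym (weightAt-translates X A p)) (odd p)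

-- Products of cubes

record Splitting (n a b : ℕ) : Set where
  field
    join : Point a → Point b → Point n
    left : Point n → Point a
    right : Point n → Point b
    left-join : ∀ x y → left (join x y) ≡ x
    right-join : ∀ x y → right (join x y) ≡ y
    join-left-right : ∀ p → join (left p) (right p) ≡ p
    hamming-join : ∀ x x′ y y′ → hamming (join x y) (join x′ y′) ≡ hamming x x′ + hamming y y′

++-splitting : ∀ a b → Splitting (a + b) a b
++-splitting a b = record
  { join = _++_
  ; left = take a
  ; right = drop a
  ; left-join = λ x y → ++-injectiveˡ (take a (x ++ y)) x (take++drop≡id a (x ++ y))
  ; right-join = λ x y → ++-injectiveʳ (take a (x ++ y)) x (take++drop≡id a (x ++ y))
  ; join-left-right = take++drop≡id a
  ; hamming-join = hamming-++ }

swap : ∀ {n a b} → Splitting n a b → Splitting n b a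
swap S = record
  { join = λ y x → join x y
  ; left = right
  ; right = left
  ; left-join = λ y x → right-join x y
  ; right-join = λ y x → left-join x y
  ; join-left-right = join-left-right
  ; hamming-join = λ y y′ x x′ → trans (hamming-join x x′ y y′) (+-comm (hamming x x′) _) }
  where open Splitting S

weightAt-++ : ∀ {k n} {X : Subcube k} (xs ys : List (WeightedCopy n X)) p →
  weightAt (xs ++ₗ ys) p ≡ weightAt xs p + weightAt ys p
weightAt-++ [] ys p = refl
weightAt-++ (w ∷ xs) ys p with copy w p
... | true = trans (cong (weight w +_) (weightAt-++ xs ys p)) (sym (+-assoc (weight w) _ _))
... | false = weightAt-++ xs ys p

weightAt-map : ∀ {k m n} {X : Subcube k} (f : WeightedCopy m X → WeightedCopy n X) c {p p′} →
  (∀ w → copy (f w) p ≡ copy w p′) → (∀ w → weight (f w) ≡ c * weight w) →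
  ∀ ws → weightAt (map f ws) p ≡ c * weightAt ws p′
weightAt-map f c same scaled [] = sym (*-zeroʳ c)
weightAt-map f c {p} {p′} same scaled (w ∷ ws)
  with copy (f w) p | copy w p′ | same w | weightAt-map f c same scaled ws
... | true | true | refl | ih = trans (cong₂ _+_ (scaled w) ih) (sym (*-distribˡ-+ c (weight w) _))
... | false | false | refl | ih = ih

weightAt-map-absent : ∀ {k m n} {X : Subcube k} (f : WeightedCopy m X → WeightedCopy n X) {p} →
  (∀ w → copy (f w) p ≡ false) → ∀ ws → weightAt (map f ws) p ≡ 0
weightAt-map-absent f absent [] = refl
weightAt-map-absent f {p} absent (w ∷ ws) with copy (f w) p | absent w
... | false | refl = weightAt-map-absent f absent ws

concatOver : ∀ {A : Set} n → (Point n → List A) → List A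
concatOver zero F = F []
concatOver (suc n) F = concatOver n (F ∘ (false ∷_)) ++ₗ concatOver n (F ∘ (true ∷_))

module _ {k : ℕ} {X : Subcube k} where

  weightAt-concatOver-absent : ∀ {m} n (F : Point n → List (WeightedCopy m X)) p →
    (∀ q → weightAt (F q) p ≡ 0) → weightAt (concatOver n F) p ≡ 0
  weightAt-concatOver-absent zero F p absent = absent []
  weightAt-concatOver-absent (suc n) F p absent = trans (weightAt-++ (concatOver n (F ∘ (false ∷_))) _ p)
    (cong₂ _+_ (weightAt-concatOver-absent n _ p (absent ∘ (false ∷_)))
               (weightAt-concatOver-absent n _ p (absent ∘ (true ∷_))))

  weightAt-concatOver-single : ∀ {m} n (F : Point n → List (WeightedCopy m X)) p q₀ →
    (∀ q → q ≢ q₀ → weightAt (F q) p ≡ 0) → weightAt (concatOver n F) p ≡ weightAt (F q₀) p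
  weightAt-concatOver-single zero F p [] absent = refl
  weightAt-concatOver-single (suc n) F p (false ∷ q₀) absent = trans
    (weightAt-++ (concatOver n (F ∘ (false ∷_))) _ p)
    (trans (cong₂ _+_ (weightAt-concatOver-single n _ p q₀ λ q q≢q₀ →
                         absent (false ∷ q) (q≢q₀ ∘ ∷-injectiveʳ))
                      (weightAt-concatOver-absent n _ p λ q → absent (true ∷ q) λ ()))
           (+-identityʳ _))
  weightAt-concatOver-single (suc n) F p (true ∷ q₀) absent = trans
    (weightAt-++ (concatOver n (F ∘ (false ∷_))) _ p)
    (cong₂ _+_ (weightAt-concatOver-absent n _ p λ q → absent (false ∷ q) λ ())
               (weightAt-concatOver-single n _ p q₀ λ q q≢q₀ →
                  absent (true ∷ q) (q≢q₀ ∘ ∷-injectiveʳ)))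

  module _ {n a b : ℕ} (S : Splitting n a b) where
    open Splitting S

    place : Point b → ℕ → WeightedCopy a X → WeightedCopy n X
    place q c w = record
      { copy = λ p → copy w (left p) ∧ does (q ≟ₚ right p)
      ; isCopy = φ′ , isometry , λ p → mk⇔ (to p) (from p)
      ; weight = c * weight w }
      where
      φ : Point k → Point a
      φ = proj₁ (isCopy w)
      φ-isometry : IsIsometry φ
      φ-isometry = proj₁ (proj₂ (isCopy w))
      φ-image : ∀ p → (p ∈ₛ copy w) ⇔ (Σ (Point k) λ x → (x ∈ₛ X) × (φ x ≡ p))
      φ-image = proj₂ (proj₂ (isCopy w))
      φ′ : Point k → Point n
      φ′ x = join (φ x) q
      isometry : IsIsometry φ′
      isometry x y = begin
        hamming (join (φ x) q) (join (φ y) q) ≡⟨ hamming-join (φ x) (φ y) q q ⟩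
        hamming (φ x) (φ y) + hamming q q     ≡⟨ cong₂ _+_ (φ-isometry x y) (hamming-refl q) ⟩
        hamming x y + 0                       ≡⟨ +-identityʳ _ ⟩
        hamming x y                           ∎
        where open ≡-Reasoning
      to : ∀ p → copy w (left p) ∧ does (q ≟ₚ right p) ≡ true →
        Σ (Point k) λ x → (x ∈ₛ X) × (φ′ x ≡ p)
      to p p∈ with q ≟ₚ right p
      ... | yes refl =
        let x , x∈X , φx≡ = Equivalence.to (φ-image (left p)) (trans (sym (∧-identityʳ _)) p∈)
        in x , x∈X , trans (cong (λ l → join l (right p)) φx≡) (join-left-right p)
      ... | no _ = contradiction (trans (sym (∧-zeroʳ _)) p∈) λ ()
      from : ∀ p → (Σ (Point k) λ x → (x ∈ₛ X) × (φ′ x ≡ p)) →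
        copy w (left p) ∧ does (q ≟ₚ right p) ≡ true
      from .(join (φ x) q) (x , x∈X , refl) = cong₂ _∧_
        (trans (cong (copy w) (left-join (φ x) q)) (Equivalence.from (φ-image (φ x)) (x , x∈X , refl)))
        (dec-true (q ≟ₚ right (join (φ x) q)) (sym (right-join (φ x) q)))

    placeAll : (Point b → ℕ) → List (WeightedCopy a X) → List (WeightedCopy n X)
    placeAll c ws = concatOver b λ q → map (place q (c q)) ws

    weightAt-placeAll : ∀ c ws p → weightAt (placeAll c ws) p ≡ c (right p) * weightAt ws (left p)
    weightAt-placeAll c ws p = trans
      (weightAt-concatOver-single b _ p (right p) λ q q≢ →
        weightAt-map-absent (place q (c q))
          (λ w → trans (cong (copy w (left p) ∧_) (dec-false (q ≟ₚ right p) q≢)) (∧-zeroʳ _)) ws)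
      (weightAt-map (place (right p) (c (right p))) (c (right p))
        (λ w → trans (cong (copy w (left p) ∧_) (dec-true (right p ≟ₚ right p) refl)) (∧-identityʳ _))
        (λ w → refl) ws)

  product : ∀ {a b} → List (WeightedCopy a X) → List (WeightedCopy b X) → ℕ →
    List (WeightedCopy (a + b) X)
  product {a} {b} ws₁ ws₂ c =
    placeAll S (const 1) ws₁ ++ₗ
    (placeAll (swap S) (const 1) ws₂ ++ₗ placeAll S (λ v → c * weightAt ws₂ v) ws₁)
    where S = ++-splitting a b

  weightAt-product : ∀ {a b} ws₁ ws₂ c (p : Point (a + b)) →
    let x = weightAt ws₁ (take a p); y = weightAt ws₂ (drop a p)
    in weightAt (product ws₁ ws₂ c) p ≡ x + (y + c * y * x)
  weightAt-product {a} {b} ws₁ ws₂ c p = trans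
    (weightAt-++ (placeAll S (const 1) ws₁) _ p)
    (cong₂ _+_ (trans (weightAt-placeAll S (const 1) ws₁ p) (*-identityˡ _))
      (trans (weightAt-++ (placeAll (swap S) (const 1) ws₂) _ p)
        (cong₂ _+_ (trans (weightAt-placeAll (swap S) (const 1) ws₂ p) (*-identityˡ _))
                   (weightAt-placeAll S (λ v → c * weightAt ws₂ v) ws₁ p))))
    where S = ++-splitting a b

oneMod-product : ∀ {r r′ x y} R → suc R ≡ r * r′ → OneMod r x → OneMod r′ y →
  OneMod (r * r′) (x + (y + R * y * x))
oneMod-product {r} {r′} R R+1≡rr′ (s , refl) (t , refl) = V + R * s * t , (begin
  (1 + r * s) + ((1 + r′ * t) + R * (1 + r′ * t) * (1 + r * s)) ≡⟨ expand R r r′ s t ⟩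
  1 + (V + R * V + R * (s * t) * (r * r′))
    ≡⟨ cong (λ m → 1 + (V + R * V + R * (s * t) * m)) (sym R+1≡rr′) ⟩
  1 + (V + R * V + R * (s * t) * suc R)      ≡⟨ collect R r r′ s t ⟩
  1 + suc R * (V + R * s * t)                ≡⟨ cong (λ m → 1 + m * (V + R * s * t)) R+1≡rr′ ⟩
  1 + (r * r′) * (V + R * s * t)             ∎)
  where
  open ≡-Reasoning
  V = 1 + r * s + r′ * t
  expand : ∀ R r r′ s t → (1 + r * s) + ((1 + r′ * t) + R * (1 + r′ * t) * (1 + r * s))
    ≡ 1 + ((1 + r * s + r′ * t) + R * (1 + r * s + r′ * t) + R * (s * t) * (r * r′))
  expand = solve-∀
  collect : ∀ R r r′ s t → 1 + ((1 + r * s + r′ * t) + R * (1 + r * s + r′ * t) + R * (s * t) * suc R)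
    ≡ 1 + suc R * (1 + r * s + r′ * t + R * s * t)
  collect = solve-∀

oneMod⇒≡1[mod] : ∀ d {r u} → OneMod (d * r) u → u ≡ 1 [mod r ]
oneMod⇒≡1[mod] d (s , refl) = n∣m*n*o d s

-- Covers modulo powers of two

oneModPow2Cover : ∀ {d} (X : Subcube d) → NonEmpty X → ∀ m →
  Σ ℕ λ n → (n ≥ d) × Σ (List (WeightedCopy n X)) λ ws → ∀ p → OneMod (2 ^ suc m) (weightAt ws p)
oneModPow2Cover {d} X ne zero = d , ≤-refl , oddTranslates X ne
oneModPow2Cover {d} X ne (suc m) =
  let n , _ , ws , good = oneModPow2Cover X ne m
      ws₀ , odd = oddTranslates X ne
      R = pred (2 ^ suc (suc m))
      R+1≡2^m+2 = suc-pred (2 ^ suc (suc m)) {{m^n≢0 2 (suc (suc m))}}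
  in d + n , m≤m+n d n , product ws₀ ws R , λ p →
       subst (OneMod (2 ^ suc (suc m))) (sym (weightAt-product ws₀ ws R p))
         (oneMod-product {2} {2 ^ suc m} R R+1≡2^m+2 (odd (take d p)) (good (drop d p)))

lemma1 : (k : ℕ) → (X : Subcube (suc k)) → NonEmpty X → (r : ℕ) → IsPowerOf2 r →
  Σ ℕ λ n → (n ≥ suc k) × Σ (List (WeightedCopy n X)) λ w →
    ∀ (p : Point n) → weightAt w p ≡ 1 [mod r ]
lemma1 k X ne .(2 ^ m) (m , refl) =
  let n , n≥ , ws , good = oneModPow2Cover X ne m
  in n , n≥ , ws , λ p → oneMod⇒≡1[mod] 2 (good p)
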